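{- Let $q$ be odd, $n\ge1$, and let $i_0,i_1,\dots,i_{q-1}\in Q_q$ satisfy $\sum_{j=0}^{q-1}i_j=0$ (mod $q$). Let $L_0$ be a latin $n$-cube of order $q$. Then the layer-latin $(n+1)$-cube of order $q$ with layers $L_0,L[\varepsilon_{i_1},n],\dots,L[\varepsilon_{i_{q-1}},n]$ has no transversal if and only if $L_0(x)\neq L[\varepsilon_{i_0},n](x)$ for every cell $x\in Q_q^n$.
   Context: $Q_q=\{0,\dots,q-1\}$, $+$ is addition modulo $q$, and $\varepsilon_i$ is the permutation $x\mapsto x+i$ of $Q_q$. A latin $n$-cube of order $q$ is a map $Q_q^n\to Q_q$ such that every line (cells obtained by fixing all coordinates but one) contains all $q$ symbols. For a permutation $\pi$ of $Q_q$, $L[\pi,n]$ is the latin $n$-cube $(x_1,\dots,x_n)\mapsto \pi(x_1)+x_2+\dots+x_n$. A layer-latin $(n+1)$-cube of order $q$ is an array of size $q\times\cdots\times q$ ($n+1$ dimensions) over $Q_q$ each of whose layers (first coordinate fixed) is a latin $n$-cube; its hyperplanes are the cell sets obtained by fixing any one of its $n+1$ coordinates; a transversal is a set of $q$ cells with at most one cell in each hyperplane and pairwise distinct symbols. -}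

module Defs where

open import Data.Nat using (ℕ; zero; suc; NonZero)
open import Data.Nat.DivMod using (_mod_)
open import Data.Fin using (Fin; toℕ) renaming (zero to fzero)
open import Data.Vec.Functional using (updateAt; foldr; head; tail)
open import Data.Product using (∃)
open import Relation.Binary.PropositionalEquality using (_≡_)
open import Relation.Nullary using (yes; no)
open import Function using (const)
open import Function.Definitions using (Injective)
import Data.Nat as ℕ

_⊕_ : {q : ℕ} .{{_ : NonZero q}} → Fin q → Fin q → Fin q
_⊕_ {q} a b = (toℕ a ℕ.+ toℕ b) mod q

zeroQ : {q : ℕ} .{{_ : NonZero q}} → Fin q
zeroQ {q} = 0 mod q

sumQ : {q : ℕ} .{{_ : NonZero q}} {k : ℕ} → (Fin k → Fin q) → Fin q
sumQ f = foldr _⊕_ zeroQ f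

ε : {q : ℕ} .{{_ : NonZero q}} → Fin q → Fin q → Fin q
ε i x = x ⊕ i

Cell : ℕ → ℕ → Set
Cell q n = Fin n → Fin q

Cube : ℕ → ℕ → Set
Cube q n = Cell q n → Fin q

IsLatin : {q n : ℕ} → Cube q n → Set
IsLatin {q} {n} L =
  (x : Cell q n) (k : Fin n) (s : Fin q) → ∃ λ a → L (updateAt x k (const a)) ≡ s

-- L[π,n] : (x₁,…,xₙ) ↦ π(x₁) + x₂ + … + xₙ   (n = suc m ≥ 1)
Lπ : {q : ℕ} .{{_ : NonZero q}} (π : Fin q → Fin q) (m : ℕ) → Cube q (suc m)
Lπ π m x = foldr _⊕_ (π (head x)) (tail x)

-- (n+1)-dimensional arrays: first coordinate = layer index
Array : ℕ → ℕ → Set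
Array q n = Cell q (suc n) → Fin q

layers : {q n : ℕ} → (Fin q → Cube q n) → Array q n
layers C x = C (head x) (tail x)

IsLayerLatin : {q n : ℕ} → Array q n → Set
IsLayerLatin {q} {n} A = (j : Fin q) → IsLatin (λ x → A (λ { fzero → j ; (Fin.suc k) → x k }))

-- a transversal: q cells T 0,…,T (q-1) such that any hyperplane (coordinate k
-- fixed to a value) contains at most one of them, i.e. for each coordinate k the
-- map t ↦ T t k is injective, and the symbols are pairwise distinct.
-- (These conditions force the q cells to be distinct.)
IsTransversal : {q n : ℕ} → Array q n → (Fin q → Cell q (suc n)) → Set
IsTransversal {q} {n} A T =
  ((k : Fin (suc n)) → Injective _≡_ _≡_ (λ t → T t k)) ×' Injective _≡_ _≡_ (λ t → A (T t))
  where open import Data.Product renaming (_×_ to _×'_)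

HasTransversal : {q n : ℕ} → Array q n → Set
HasTransversal {q} {n} A = ∃ λ (T : Fin q → Cell q (suc n)) → IsTransversal A T

layerArray : {q : ℕ} .{{_ : NonZero q}} (m : ℕ) → Cube q (suc m) → (Fin q → Fin q) → Array q (suc m)
layerArray m L₀ i = layers (λ j → choose j)
  where
  choose : _ → Cube _ (suc m)
  choose j with toℕ j ℕ.≟ 0
  ... | yes _ = L₀
  ... | no  _ = Lπ (ε (i j)) m

module Submission where

-- Every column of a transversal is a bijection onto Q_q, and for odd q the elements of Q_q sum to 0.
-- Let U be the array whose layer j is L[ε_{i_j},n] for every j, so U(j, y₁, …, yₙ) = y₁ + ⋯ + yₙ + i_j.
-- On any q cells with bijective columns the symbols of U sum to Σ_j i_j = 0, and the symbols of a
-- transversal sum to 0 as well. The given array differs from U only in layer 0, so L₀ and L[ε_{i₀},n]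
-- agree at the layer-0 cell of any transversal.
-- Conversely, let them agree at x. Hall's theorem gives permutations b, c of Q_q with c_j = b_j + a_j
-- for all j ≠ 0, where a_j = i_j + Σ_{k≥2} (x_k + j). The cells (j, b_j + t, x₂ + j, …, xₙ + j) with
-- t = x₁ − b₀ have bijective columns, the one for j = 0 is (0, x), and for j ≠ 0 the symbol is c_j + t;
-- the zero sum forces the symbol at (0, x) to be the remaining value c₀ + t, so all symbols differ.

open import Defs
open import Algebra.Bundles using (AbelianGroup)
open import Algebra.Core using (Op₁; Op₂)
open import Algebra.Structures using (IsAbelianGroup)
import Algebra.Properties.AbelianGroup as AbelianGroupProperties
import Algebra.Properties.CommutativeMonoid.Sum as CommutativeMonoidSum
import Algebra.Properties.CommutativeSemigroup as CommutativeSemigroupProperties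
import Algebra.Properties.Group as GroupProperties
open import Data.Fin using (Fin; zero; suc; toℕ; fromℕ<; punchIn; punchOut)
open import Data.Fin.Properties
  using ( _≟_; any?; pigeonhole; punchInᵢ≢i; punchOut-injective; injective⇒≤
        ; toℕ<n; toℕ-fromℕ<; toℕ-injective)
open import Data.Fin.Permutation as Perm
  using (Permutation; permutation; transpose; flip; _∘ₚ_; _⟨$⟩ʳ_; _⟨$⟩ˡ_)
open import Data.Nat as ℕ using (ℕ; zero; suc; NonZero; _+_; _*_; _∸_; _%_; _≤_; _<_; z≤n; s≤s; >-nonZero⁻¹)
open import Data.Nat.Coprimality using (Coprime; coprime-divisor)
open import Data.Nat.DivMod using (_mod_; %-distribˡ-+; [m+n]%n≡m%n; m<n⇒m%n≡m)
open import Data.Nat.Divisibility using (_∣_; ∣⇒≤; 0∣⇒≡0; m%n≡0⇒n∣m; n∣m⇒m%n≡0)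
open import Data.Nat.GeneralisedArithmetic using (fold)
import Data.Nat.Properties as ℕ
open import Data.Product using (∃; _×_; _,_; proj₁; proj₂)
open import Data.Sum using (_⊎_; inj₁; inj₂; [_,_]′)
open import Data.Vec.Functional using (foldr; head; tail; removeAt)
open import Function using (_∘_; id)
open import Function.Bundles using (_⇔_; mk⇔)
open import Function.Definitions using (Injective)
open import Level using (0ℓ)
open import Relation.Binary.PropositionalEquality
open import Relation.Nullary using (¬_; yes; no; contradiction)
open import Relation.Nullary.Decidable using (_⊎-dec_)
open import Relation.Unary using (Pred; Decidable)

private variable n : ℕ

Least : ∀ {p} → Pred ℕ p → Pred ℕ p
Least P m = P m × (∀ {k} → k < m → ¬ P k)

search≤ : ∀ {p} {P : Pred ℕ p} → Decidable P → ∀ d →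
          (∃ λ m → m ≤ d × Least P m) ⊎ (∀ {k} → k ≤ d → ¬ P k)
search≤ P? zero with P? 0
... | yes p = inj₁ (0 , z≤n , p , λ ())
... | no ¬p = inj₂ λ { z≤n → ¬p }
search≤ P? (suc d) with search≤ P? d
... | inj₁ (m , m≤d , m-least) = inj₁ (m , ℕ.m≤n⇒m≤1+n m≤d , m-least)
... | inj₂ none with P? (suc d)
...   | yes p = inj₁ (suc d , ℕ.≤-refl , p , none ∘ ℕ.s≤s⁻¹)
...   | no ¬p = inj₂ λ k≤1+d → [ none ∘ ℕ.s≤s⁻¹ , (λ { refl → ¬p }) ]′ (ℕ.m≤n⇒m<n∨m≡n k≤1+d)

least : ∀ {p} {P : Pred ℕ p} → Decidable P → ∀ {d} → P d → ∃ (Least P)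
least P? {d} p with search≤ P? d
... | inj₁ (m , _ , m-least) = m , m-least
... | inj₂ none = contradiction p (none ℕ.≤-refl)

injective⇒surjective : {f : Fin n → Fin n} → Injective _≡_ _≡_ f → ∀ y → ∃ λ x → f x ≡ y
injective⇒surjective {suc n} {f} f-inj y with any? (λ x → f x ≟ y)
... | yes found = found
... | no ¬found = contradiction (injective⇒≤ punchOut∘f-injective) ℕ.1+n≰n
  where
  y≢f : ∀ x → y ≢ f x
  y≢f x eq = ¬found (x , sym eq)
  punchOut∘f-injective : Injective _≡_ _≡_ (λ x → punchOut (y≢f x))
  punchOut∘f-injective eq = f-inj (punchOut-injective (y≢f _) (y≢f _) eq)

fromInjective : (f : Fin n → Fin n) → Injective _≡_ _≡_ f → Permutation n n
fromInjective f f-inj =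
  permutation f (proj₁ ∘ preimage) (proj₂ ∘ preimage) (λ x → f-inj (proj₂ (preimage (f x))))
  where preimage = injective⇒surjective f-inj

⟨$⟩ʳ⇒⟨$⟩ˡ : (π : Permutation n n) {x y : Fin n} → π ⟨$⟩ʳ x ≡ y → π ⟨$⟩ˡ y ≡ x
⟨$⟩ʳ⇒⟨$⟩ˡ π refl = Perm.inverseˡ π

⟨$⟩ʳ-injective : (π : Permutation n n) → Injective _≡_ _≡_ (π ⟨$⟩ʳ_)
⟨$⟩ʳ-injective π eq = trans (sym (Perm.inverseˡ π)) (⟨$⟩ʳ⇒⟨$⟩ˡ π (sym eq))

orbit-returns : {f : Fin n → Fin n} → Injective _≡_ _≡_ f → ∀ x → ∃ λ d → fold x f (suc d) ≡ x
orbit-returns {n} {f} f-inj x with pigeonhole (ℕ.n<1+n n) (λ k → fold x f (toℕ k))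
... | i , j , i<j , eq with ℕ.m≤n⇒∃[o]m+o≡n i<j
...   | d , 1+i+d≡j = d , sym (unwind (toℕ i) (trans eq (cong (fold x f) (sym 1+i+d≡j))))
  where
  unwind : ∀ k {d} → fold x f k ≡ fold x f (suc k + d) → x ≡ fold x f (suc d)
  unwind zero    eq = eq
  unwind (suc k) eq = unwind k (f-inj eq)

transpose-appliedˡ : (i j : Fin n) → transpose i j ⟨$⟩ʳ i ≡ j
transpose-appliedˡ i j with i ≟ i
... | yes _   = refl
... | no i≢i = contradiction refl i≢i

transpose-appliedʳ : (i j : Fin n) → transpose i j ⟨$⟩ʳ j ≡ i
transpose-appliedʳ i j with j ≟ i
... | yes refl = refl
... | no _ with j ≟ j
...   | yes _   = refl
...   | no j≢j = contradiction refl j≢j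

transpose-fixes : ∀ {i j k : Fin n} → k ≢ i → k ≢ j → transpose i j ⟨$⟩ʳ k ≡ k
transpose-fixes {i = i} {j} {k} k≢i k≢j with k ≟ i
... | yes k≡i = contradiction k≡i k≢i
... | no _ with k ≟ j
...   | yes k≡j = contradiction k≡j k≢j
...   | no _    = refl

InjectiveUpTo : ℕ → (ℕ → Fin n) → Set
InjectiveUpTo L r = ∀ {i j} → i ≤ L → j ≤ L → r i ≡ r j → i ≡ j

injectiveUpTo-tail : ∀ {L} {r : ℕ → Fin n} → InjectiveUpTo (suc L) r → InjectiveUpTo L (r ∘ suc)
injectiveUpTo-tail r-inj i≤L j≤L = ℕ.suc-injective ∘ r-inj (s≤s i≤L) (s≤s j≤L)

-- The cycle r 0 ↦ r 1 ↦ ⋯ ↦ r L ↦ r 0, as a product of transpositions.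
cycle : ℕ → (ℕ → Fin n) → Permutation n n
cycle zero    r = Perm.id
cycle (suc L) r = cycle L (r ∘ suc) ∘ₚ transpose (r 0) (r 1)

cycle-fixes : ∀ L {r : ℕ → Fin n} {x} → (∀ {k} → k ≤ L → r k ≢ x) → cycle L r ⟨$⟩ʳ x ≡ x
cycle-fixes zero    x∉r = refl
cycle-fixes (suc L) {r} x∉r =
  trans (cong (transpose (r 0) (r 1) ⟨$⟩ʳ_) (cycle-fixes L (x∉r ∘ s≤s)))
        (transpose-fixes (x∉r z≤n ∘ sym) (x∉r (s≤s z≤n) ∘ sym))

cycle-step : ∀ L {r : ℕ → Fin n} → InjectiveUpTo L r → ∀ {k} → k < L → cycle L r ⟨$⟩ʳ r k ≡ r (suc k)
cycle-step (suc L) {r} r-inj {zero} _ =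
  trans (cong (transpose (r 0) (r 1) ⟨$⟩ʳ_) (cycle-fixes L λ k≤L eq → ℕ.1+n≢0 (r-inj (s≤s k≤L) z≤n eq)))
        (transpose-appliedˡ (r 0) (r 1))
cycle-step (suc L) {r} r-inj {suc k} (s≤s k<L) =
  trans (cong (transpose (r 0) (r 1) ⟨$⟩ʳ_) (cycle-step L (injectiveUpTo-tail r-inj) k<L))
        (transpose-fixes (ℕ.1+n≢0 ∘ r-inj (s≤s k<L) z≤n)
                         (ℕ.1+n≢0 ∘ ℕ.suc-injective ∘ r-inj (s≤s k<L) (s≤s z≤n)))

cycle-closes : ∀ L {r : ℕ → Fin n} → InjectiveUpTo L r → cycle L r ⟨$⟩ʳ r L ≡ r 0
cycle-closes zero    r-inj = refl
cycle-closes (suc L) {r} r-inj =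
  trans (cong (transpose (r 0) (r 1) ⟨$⟩ʳ_) (cycle-closes L (injectiveUpTo-tail r-inj)))
        (transpose-appliedʳ (r 0) (r 1))

-- Hall's theorem for abelian groups on Fin n

module FiniteAbelianGroup {n : ℕ} {_∙_ : Op₂ (Fin n)} {ε : Fin n} {_⁻¹ : Op₁ (Fin n)}
                          (isAbelianGroup : IsAbelianGroup _≡_ _∙_ ε _⁻¹) where

  private
    abelianGroup : AbelianGroup 0ℓ 0ℓ
    abelianGroup = record { isAbelianGroup = isAbelianGroup }

  open AbelianGroup abelianGroup
    using (group; commutativeMonoid; commutativeSemigroup; _-_; assoc; identityˡ; identityʳ; inverseʳ)
  open GroupProperties group public using (∙-cancelˡ; ∙-cancelʳ)
  open GroupProperties group using (//-rightDividesˡ; ⁻¹-injective; ε⁻¹≈ε)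
  open AbelianGroupProperties abelianGroup using (⁻¹-∙-comm)
  open CommutativeSemigroupProperties commutativeSemigroup using (xy∙z≈zy∙x)
  open CommutativeMonoidSum commutativeMonoid public
    using (sum; sum-cong-≗; ∑-distrib-+; ∑-comm; sum-replicate-zero)
  open CommutativeMonoidSum commutativeMonoid using (sum-permute; sum-remove)

  foldr-∙ : ∀ {k} z (v : Fin k → Fin n) → foldr _∙_ z v ≡ sum v ∙ z
  foldr-∙ {zero}  z v = sym (identityˡ z)
  foldr-∙ {suc k} z v = trans (cong (v zero ∙_) (foldr-∙ z (v ∘ suc))) (sym (assoc _ _ _))

  sum-∘-injective : {f : Fin n → Fin n} → Injective _≡_ _≡_ f → ∀ g → sum (g ∘ f) ≡ sum g
  sum-∘-injective f-inj g = sym (sum-permute g (fromInjective _ f-inj))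

  total : Fin n
  total = sum id

  sum-injective : {f : Fin n → Fin n} → Injective _≡_ _≡_ f → sum f ≡ total
  sum-injective f-inj = sum-∘-injective f-inj id

  sum-⁻¹ : ∀ {k} (f : Fin k → Fin n) → sum (λ j → f j ⁻¹) ≡ sum f ⁻¹
  sum-⁻¹ {zero}  f = sym ε⁻¹≈ε
  sum-⁻¹ {suc k} f = trans (cong ((f zero ⁻¹) ∙_) (sum-⁻¹ (f ∘ suc))) (⁻¹-∙-comm _ _)

  total∙total≡ε : total ∙ total ≡ ε
  total∙total≡ε = begin
    total ∙ total        ≡⟨ cong (total ∙_) (sum-injective ⁻¹-injective) ⟨
    total ∙ sum _⁻¹      ≡⟨ cong (total ∙_) (sum-⁻¹ id) ⟩
    total ∙ (total ⁻¹)   ≡⟨ inverseʳ total ⟩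
    ε                    ∎
    where open ≡-Reasoning

  sum-unique-at : ∀ {k} {f g : Fin k → Fin n} j → (∀ l → l ≢ j → f l ≡ g l) → sum f ≡ sum g → f j ≡ g j
  sum-unique-at {suc k} {f} {g} j f≗g sum-f≡sum-g = ∙-cancelʳ (sum (removeAt f j)) (f j) (g j) (begin
    f j ∙ sum (removeAt f j) ≡⟨ sum-remove f ⟨
    sum f                    ≡⟨ sum-f≡sum-g ⟩
    sum g                    ≡⟨ sum-remove g ⟩
    g j ∙ sum (removeAt g j) ≡⟨ cong (g j ∙_) (sum-cong-≗ λ l → f≗g (punchIn j l) (punchInᵢ≢i j l)) ⟨
    g j ∙ sum (removeAt f j) ∎)
    where open ≡-Reasoning

  record Realisation (a : Fin n → Fin n) (v : Fin n) : Set where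
    field
      left right : Permutation n n
      realises : ∀ j → j ≢ v → right ⟨$⟩ʳ j ≡ (left ⟨$⟩ʳ j) ∙ a j

  open Realisation public

  realisation-resp : ∀ {a a′ v} → (∀ j → j ≢ v → a′ j ≡ a j) → Realisation a v → Realisation a′ v
  realisation-resp a′≡a R = record
    { left     = left R
    ; right    = right R
    ; realises = λ j j≢v → trans (realises R j j≢v) (cong ((left R ⟨$⟩ʳ j) ∙_) (sym (a′≡a j j≢v)))
    }

  -- Hall's exchange step, changing a at one index u ≠ v: follow the chain u, next u, next (next u), …,
  -- where next x is the index whose c-value pairs with b x to the constant K. Up to its first return to
  -- {u, v} the chain is injective; rotating b backwards and c forwards along it repairs the equation at
  -- u without breaking it elsewhere.
  module Exchange {a a′ : Fin n → Fin n} {u v : Fin n} (u≢v : u ≢ v)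
                  (a′≡a : ∀ j → j ≢ u → a′ j ≡ a j) (R : Realisation a v) where

    b c : Fin n → Fin n
    b = left R ⟨$⟩ʳ_
    c = right R ⟨$⟩ʳ_

    K : Fin n
    K = (b v ∙ a′ u) ∙ b u

    next : Fin n → Fin n
    next x = right R ⟨$⟩ˡ (K - b x)

    c-next : ∀ x → c (next x) ∙ b x ≡ K
    c-next x = trans (cong (_∙ b x) (Perm.inverseʳ (right R))) (//-rightDividesˡ (b x) K)

    next-injective : Injective _≡_ _≡_ next
    next-injective {x} {y} eq = ⟨$⟩ʳ-injective (left R)
      (∙-cancelˡ (c (next x)) (b x) (b y)
        (trans (c-next x) (trans (sym (c-next y)) (cong (λ z → c z ∙ b y) (sym eq)))))

    chain : ℕ → Fin n
    chain = fold u next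

    Stop : Fin n → Set
    Stop x = x ≡ u ⊎ x ≡ v

    first-stop : ∃ (Least (Stop ∘ chain ∘ suc))
    first-stop with d , chain-returns ← orbit-returns next-injective u =
      least (λ k → chain (suc k) ≟ u ⊎-dec chain (suc k) ≟ v) {d} (inj₁ chain-returns)

    m : ℕ
    m = proj₁ first-stop

    chain-stops : Stop (chain (suc m))
    chain-stops = proj₁ (proj₂ first-stop)

    chain-≢u : ∀ {k} → k < m → chain (suc k) ≢ u
    chain-≢u k<m eq = proj₂ (proj₂ first-stop) k<m (inj₁ eq)

    chain-≢v : ∀ {k} → k ≤ m → chain k ≢ v
    chain-≢v {zero}  _   = u≢v
    chain-≢v {suc k} k<m eq = proj₂ (proj₂ first-stop) k<m (inj₂ eq)

    ≢chain-stop : ∀ {x} → x ≢ u → x ≢ v → x ≢ chain (suc m)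
    ≢chain-stop x≢u x≢v eq = [ x≢u ∘ trans eq , x≢v ∘ trans eq ]′ chain-stops

    chain-injective : InjectiveUpTo m chain
    chain-injective {zero}  {zero}  _   _   _  = refl
    chain-injective {zero}  {suc j} _   j<m eq = contradiction (sym eq) (chain-≢u j<m)
    chain-injective {suc i} {zero}  i<m _   eq = contradiction eq (chain-≢u i<m)
    chain-injective {suc i} {suc j} i<m j<m eq =
      cong suc (chain-injective (ℕ.<⇒≤ i<m) (ℕ.<⇒≤ j<m) (next-injective eq))

    -- transpose u (chain (suc m)) is the identity if the chain stops at u, and otherwise closes the
    -- cycle of σc through v.
    ρ σb σc : Permutation n n
    ρ  = cycle m chain
    σb = transpose u v ∘ₚ flip ρ
    σc = ρ ∘ₚ transpose u (chain (suc m))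

    σc-chain : ∀ {k} → k ≤ m → σc ⟨$⟩ʳ chain k ≡ chain (suc k)
    σc-chain k≤m with ℕ.m≤n⇒m<n∨m≡n k≤m
    ... | inj₁ k<m = trans (cong (transpose u (chain (suc m)) ⟨$⟩ʳ_) (cycle-step m chain-injective k<m))
                           (transpose-fixes (chain-≢u k<m) (≢chain-stop (chain-≢u k<m) (chain-≢v k<m)))
    ... | inj₂ refl = trans (cong (transpose u (chain (suc m)) ⟨$⟩ʳ_) (cycle-closes m chain-injective))
                            (transpose-appliedˡ u (chain (suc m)))

    σb-u : σb ⟨$⟩ʳ u ≡ v
    σb-u = trans (cong (ρ ⟨$⟩ˡ_) (transpose-appliedˡ u v)) (⟨$⟩ʳ⇒⟨$⟩ˡ ρ (cycle-fixes m (chain-≢v)))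

    σb-chain : ∀ {k} → k < m → σb ⟨$⟩ʳ chain (suc k) ≡ chain k
    σb-chain k<m = trans (cong (ρ ⟨$⟩ˡ_) (transpose-fixes (chain-≢u k<m) (chain-≢v k<m)))
                         (⟨$⟩ʳ⇒⟨$⟩ˡ ρ (cycle-step m chain-injective k<m))

    module _ {x} (x∉chain : ∀ {k} → k ≤ m → chain k ≢ x) (x≢v : x ≢ v) where

      σb-fixes : σb ⟨$⟩ʳ x ≡ x
      σb-fixes = trans (cong (ρ ⟨$⟩ˡ_) (transpose-fixes (x∉chain z≤n ∘ sym) x≢v))
                       (⟨$⟩ʳ⇒⟨$⟩ˡ ρ (cycle-fixes m x∉chain))

      σc-fixes : σc ⟨$⟩ʳ x ≡ x
      σc-fixes = trans (cong (transpose u (chain (suc m)) ⟨$⟩ʳ_) (cycle-fixes m x∉chain))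
                       (transpose-fixes (x∉chain z≤n ∘ sym) (≢chain-stop (x∉chain z≤n ∘ sym) x≢v))

    c-next-chain : ∀ {k} → k < m → c (next (chain (suc k))) ≡ b (chain k) ∙ a (chain (suc k))
    c-next-chain {k} k<m = ∙-cancelʳ (b x) _ _ (begin
      c (next x) ∙ b x            ≡⟨ c-next x ⟩
      K                           ≡⟨ c-next (chain k) ⟨
      c x ∙ b (chain k)           ≡⟨ cong (_∙ b (chain k)) (realises R x (chain-≢v k<m)) ⟩
      (b x ∙ a x) ∙ b (chain k)   ≡⟨ xy∙z≈zy∙x (b x) (a x) (b (chain k)) ⟩
      (b (chain k) ∙ a x) ∙ b x   ∎)
      where
      open ≡-Reasoning
      x = chain (suc k)

    realises-on-chain : ∀ {k} → k ≤ m → c (σc ⟨$⟩ʳ chain k) ≡ b (σb ⟨$⟩ʳ chain k) ∙ a′ (chain k)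
    realises-on-chain {zero} _ = begin
      c (σc ⟨$⟩ʳ u)       ≡⟨ cong c (σc-chain z≤n) ⟩
      c (next u)          ≡⟨ ∙-cancelʳ (b u) _ _ (c-next u) ⟩
      b v ∙ a′ u          ≡⟨ cong (λ y → b y ∙ a′ u) σb-u ⟨
      b (σb ⟨$⟩ʳ u) ∙ a′ u ∎
      where open ≡-Reasoning
    realises-on-chain {suc k} k<m = begin
      c (σc ⟨$⟩ʳ x)        ≡⟨ cong c (σc-chain k<m) ⟩
      c (next x)           ≡⟨ c-next-chain k<m ⟩
      b (chain k) ∙ a x    ≡⟨ cong₂ (λ y z → b y ∙ z) (σb-chain k<m) (a′≡a x (chain-≢u k<m)) ⟨
      b (σb ⟨$⟩ʳ x) ∙ a′ x  ∎
      where
      open ≡-Reasoning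
      x = chain (suc k)

    realises′ : ∀ x → x ≢ v → c (σc ⟨$⟩ʳ x) ≡ b (σb ⟨$⟩ʳ x) ∙ a′ x
    realises′ x x≢v with search≤ (λ k → chain k ≟ x) m
    ... | inj₁ (k , k≤m , refl , _) = realises-on-chain k≤m
    ... | inj₂ x∉chain = begin
      c (σc ⟨$⟩ʳ x)        ≡⟨ cong c (σc-fixes x∉chain x≢v) ⟩
      c x                  ≡⟨ realises R x x≢v ⟩
      b x ∙ a x            ≡⟨ cong₂ (λ y z → b y ∙ z) (σb-fixes x∉chain x≢v) (a′≡a x (x∉chain z≤n ∘ sym)) ⟨
      b (σb ⟨$⟩ʳ x) ∙ a′ x  ∎
      where open ≡-Reasoning

    realisation′ : Realisation a′ v
    realisation′ = record { left = σb ∘ₚ left R ; right = σc ∘ₚ right R ; realises = realises′ }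

  exchange : ∀ {a a′ v} u → (∀ j → j ≢ u → a′ j ≡ a j) → Realisation a v → Realisation a′ v
  exchange {v = v} u a′≡a R with u ≟ v
  ... | yes refl = realisation-resp a′≡a R
  ... | no u≢v  = Exchange.realisation′ u≢v a′≡a R

  realisation : ∀ a v → Realisation a v
  realisation a v = realisation-resp (λ j _ → sym (prefix-total j)) (extend n ℕ.≤-refl)
    where
    prefix : ℕ → Fin n → Fin n
    prefix k j with toℕ j ℕ.<? k
    ... | yes _ = a j
    ... | no  _ = ε

    prefix-empty : ∀ j → prefix 0 j ≡ ε
    prefix-empty j with toℕ j ℕ.<? 0
    ... | no _ = refl

    prefix-total : ∀ j → prefix n j ≡ a j
    prefix-total j with toℕ j ℕ.<? n
    ... | yes _ = refl
    ... | no j≮n = contradiction (toℕ<n j) j≮n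

    prefix-step : ∀ {k} (k<n : k < n) j → j ≢ fromℕ< k<n → prefix (suc k) j ≡ prefix k j
    prefix-step {k} k<n j j≢k with toℕ j ℕ.<? suc k | toℕ j ℕ.<? k
    ... | yes _   | yes _   = refl
    ... | no  _   | no  _   = refl
    ... | no j≮1+k | yes j<k = contradiction (ℕ.m≤n⇒m≤1+n j<k) j≮1+k
    ... | yes j<1+k | no j≮k = contradiction (toℕ-injective (trans j≡k (sym (toℕ-fromℕ< k<n)))) j≢k
      where j≡k = ℕ.≤-antisym (ℕ.s≤s⁻¹ j<1+k) (ℕ.≮⇒≥ j≮k)

    trivial : Realisation (prefix 0) v
    trivial = realisation-resp (λ j _ → prefix-empty j)
      (record { left = Perm.id ; right = Perm.id ; realises = λ j _ → sym (identityʳ j) })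

    extend : ∀ k → k ≤ n → Realisation (prefix k) v
    extend zero    _   = trivial
    extend (suc k) k<n = exchange (fromℕ< k<n) (prefix-step k<n) (extend k (ℕ.<⇒≤ k<n))

odd⇒coprime-2 : ∀ {q} → q % 2 ≡ 1 → Coprime q 2
odd⇒coprime-2 odd {zero}  (_ , 0∣2) = contradiction (0∣⇒≡0 0∣2) λ ()
odd⇒coprime-2 odd {1}     _         = refl
odd⇒coprime-2 odd {2}     (2∣q , _) = contradiction (trans (sym odd) (n∣m⇒m%n≡0 _ 2 2∣q)) λ ()
odd⇒coprime-2 odd {suc (suc (suc d))} (_ , 3+d∣2) = contradiction (∣⇒≤ 3+d∣2) λ { (ℕ.s≤s (ℕ.s≤s ())) }

module Modular (q : ℕ) .{{_ : NonZero q}} where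

  private
    toℕ-mod : ∀ x → toℕ (x mod q) ≡ x % q
    toℕ-mod x = toℕ-fromℕ< _

  %≡%⇒mod≡mod : ∀ {x y} → x % q ≡ y % q → x mod q ≡ y mod q
  %≡%⇒mod≡mod eq = toℕ-injective (trans (toℕ-mod _) (trans eq (sym (toℕ-mod _))))

  mod-toℕ : (a : Fin q) → toℕ a mod q ≡ a
  mod-toℕ a = toℕ-injective (trans (toℕ-mod _) (m<n⇒m%n≡m (toℕ<n a)))

  toℕ-zeroQ : toℕ (zeroQ {q}) ≡ 0
  toℕ-zeroQ = trans (toℕ-mod 0) (m<n⇒m%n≡m (>-nonZero⁻¹ q))

  -- With mod-toℕ, this reduces the group laws of ⊕ to those of (ℕ, +, 0).
  mod-homo : ∀ x y → (x + y) mod q ≡ (x mod q) ⊕ (y mod q)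
  mod-homo x y = %≡%⇒mod≡mod
    (trans (%-distribˡ-+ x y q) (sym (cong₂ (λ s t → (s + t) % q) (toℕ-mod x) (toℕ-mod y))))

  ⊖_ : Fin q → Fin q
  ⊖ a = (q ∸ toℕ a) mod q

  ⊕-comm : (a b : Fin q) → a ⊕ b ≡ b ⊕ a
  ⊕-comm a b = cong (_mod q) (ℕ.+-comm (toℕ a) (toℕ b))

  ⊕-assoc : (a b c : Fin q) → (a ⊕ b) ⊕ c ≡ a ⊕ (b ⊕ c)
  ⊕-assoc a b c = begin
    (a ⊕ b) ⊕ c                                      ≡⟨ cong ((a ⊕ b) ⊕_) (mod-toℕ c) ⟨
    ((toℕ a + toℕ b) mod q) ⊕ (toℕ c mod q)          ≡⟨ mod-homo (toℕ a + toℕ b) (toℕ c) ⟨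
    (toℕ a + toℕ b + toℕ c) mod q                    ≡⟨ cong (_mod q) (ℕ.+-assoc (toℕ a) (toℕ b) (toℕ c)) ⟩
    (toℕ a + (toℕ b + toℕ c)) mod q                  ≡⟨ mod-homo (toℕ a) (toℕ b + toℕ c) ⟩
    (toℕ a mod q) ⊕ ((toℕ b + toℕ c) mod q)          ≡⟨ cong (_⊕ (b ⊕ c)) (mod-toℕ a) ⟩
    a ⊕ (b ⊕ c)                                      ∎
    where open ≡-Reasoning

  ⊕-identityʳ : (a : Fin q) → a ⊕ zeroQ ≡ a
  ⊕-identityʳ a = begin
    a ⊕ zeroQ                   ≡⟨ cong (_⊕ zeroQ) (mod-toℕ a) ⟨
    (toℕ a mod q) ⊕ (0 mod q)   ≡⟨ mod-homo (toℕ a) 0 ⟨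
    (toℕ a + 0) mod q           ≡⟨ cong (_mod q) (ℕ.+-identityʳ (toℕ a)) ⟩
    toℕ a mod q                 ≡⟨ mod-toℕ a ⟩
    a                           ∎
    where open ≡-Reasoning

  ⊕-inverseʳ : (a : Fin q) → a ⊕ (⊖ a) ≡ zeroQ
  ⊕-inverseʳ a = begin
    a ⊕ (⊖ a)                            ≡⟨ cong (_⊕ (⊖ a)) (mod-toℕ a) ⟨
    (toℕ a mod q) ⊕ ((q ∸ toℕ a) mod q)  ≡⟨ mod-homo (toℕ a) (q ∸ toℕ a) ⟨
    (toℕ a + (q ∸ toℕ a)) mod q          ≡⟨ cong (_mod q) (ℕ.m+[n∸m]≡n (ℕ.<⇒≤ (toℕ<n a))) ⟩
    q mod q                              ≡⟨ %≡%⇒mod≡mod ([m+n]%n≡m%n 0 q) ⟩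
    zeroQ                                ∎
    where open ≡-Reasoning

  ⊕-inverseˡ : (a : Fin q) → (⊖ a) ⊕ a ≡ zeroQ
  ⊕-inverseˡ a = trans (⊕-comm (⊖ a) a) (⊕-inverseʳ a)

  ⊕-isAbelianGroup : IsAbelianGroup _≡_ _⊕_ zeroQ ⊖_
  ⊕-isAbelianGroup = record
    { isGroup = record
      { isMonoid = record
        { isSemigroup = record
          { isMagma = record { isEquivalence = isEquivalence ; ∙-cong = cong₂ _⊕_ }
          ; assoc   = ⊕-assoc
          }
        ; identity = (λ a → trans (⊕-comm zeroQ a) (⊕-identityʳ a)) , ⊕-identityʳ
        }
      ; inverse = ⊕-inverseˡ , ⊕-inverseʳ
      ; ⁻¹-cong = cong ⊖_
      }
    ; comm = ⊕-comm
    }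

  open FiniteAbelianGroup ⊕-isAbelianGroup public

  ⊕-double≡0 : q % 2 ≡ 1 → (a : Fin q) → a ⊕ a ≡ zeroQ → a ≡ zeroQ
  ⊕-double≡0 odd a a⊕a≡0 = toℕ-injective (trans toℕa≡0 (sym toℕ-zeroQ))
    where
    q∣2*a : q ∣ 2 * toℕ a
    q∣2*a = m%n≡0⇒n∣m _ q (begin
      (toℕ a + (toℕ a + 0)) % q  ≡⟨ cong (λ x → (toℕ a + x) % q) (ℕ.+-identityʳ (toℕ a)) ⟩
      (toℕ a + toℕ a) % q        ≡⟨ toℕ-mod _ ⟨
      toℕ (a ⊕ a)                ≡⟨ cong toℕ a⊕a≡0 ⟩
      toℕ (zeroQ {q})            ≡⟨ toℕ-zeroQ ⟩
      0                          ∎)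
      where open ≡-Reasoning
    toℕa≡0 : toℕ a ≡ 0
    toℕa≡0 = trans (sym (m<n⇒m%n≡m (toℕ<n a)))
                   (n∣m⇒m%n≡0 _ q (coprime-divisor (odd⇒coprime-2 odd) q∣2*a))

  total≡0 : q % 2 ≡ 1 → total ≡ zeroQ
  total≡0 odd = ⊕-double≡0 odd total total∙total≡ε

module LayerArray {p : ℕ} (odd : suc p % 2 ≡ 1) (m : ℕ) (i : Fin (suc p) → Fin (suc p))
                  (sum-i≡0 : sumQ i ≡ zeroQ) (L₀ : Cube (suc p) (suc m)) where

  open Modular (suc p)

  A : Array (suc p) (suc m)
  A = layerArray m L₀ i

  -- A with its layer 0 replaced by L[ε_{i₀}, n]
  uniform : Array (suc p) (suc m)
  uniform x = Lπ (ε (i (head x))) m (tail x)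

  A-layer₀ : ∀ x → x zero ≡ zero → A x ≡ L₀ (tail x)
  A-layer₀ x x₀≡0 with toℕ (x zero) ℕ.≟ 0
  ... | yes _ = refl
  ... | no x₀≢0 = contradiction (cong toℕ x₀≡0) x₀≢0

  A-other-layers : ∀ x → x zero ≢ zero → A x ≡ uniform x
  A-other-layers x x₀≢0 with toℕ (x zero) ℕ.≟ 0
  ... | yes x₀≡0 = contradiction (toℕ-injective x₀≡0) x₀≢0
  ... | no _ = refl

  uniform-formula : ∀ x → uniform x ≡ sum (λ k → x (suc (suc k))) ⊕ (x (suc zero) ⊕ i (x zero))
  uniform-formula x = foldr-∙ (x (suc zero) ⊕ i (x zero)) (λ k → x (suc (suc k)))

  module _ (T : Fin (suc p) → Cell (suc p) (suc (suc m))) (T-inj : ∀ k → Injective _≡_ _≡_ (λ t → T t k)) where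

    private
      column-sum≡0 : ∀ k → sum (λ t → T t k) ≡ zeroQ
      column-sum≡0 k = trans (sum-injective (T-inj k)) (total≡0 odd)

    sum-uniform : sum (uniform ∘ T) ≡ zeroQ
    sum-uniform = begin
      sum (uniform ∘ T)
        ≡⟨ sum-cong-≗ (uniform-formula ∘ T) ⟩
      sum (λ t → sum (λ k → T t (suc (suc k))) ⊕ (T t (suc zero) ⊕ i (T t zero)))
        ≡⟨ ∑-distrib-+ (λ t → sum (λ k → T t (suc (suc k)))) (λ t → T t (suc zero) ⊕ i (T t zero)) ⟩
      sum (λ t → sum (λ k → T t (suc (suc k)))) ⊕ sum (λ t → T t (suc zero) ⊕ i (T t zero))
        ≡⟨ cong₂ _⊕_ (∑-comm (λ t k → T t (suc (suc k))))
                     (∑-distrib-+ (λ t → T t (suc zero)) (λ t → i (T t zero))) ⟩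
      sum (λ k → sum (λ t → T t (suc (suc k)))) ⊕ (sum (λ t → T t (suc zero)) ⊕ sum (λ t → i (T t zero)))
        ≡⟨ cong₂ _⊕_ (trans (sum-cong-≗ λ k → column-sum≡0 (suc (suc k))) (sum-replicate-zero m))
                     (cong₂ _⊕_ (column-sum≡0 (suc zero)) (trans (sum-∘-injective (T-inj zero) i) sum-i≡0)) ⟩
      zeroQ ⊕ (zeroQ ⊕ zeroQ)
        ≡⟨ trans (cong (zeroQ ⊕_) (⊕-identityʳ zeroQ)) (⊕-identityʳ zeroQ) ⟩
      zeroQ ∎
      where open ≡-Reasoning

  transversal⇒agreement : ∀ {T} → IsTransversal A T → ∃ λ x → L₀ x ≡ Lπ (ε (i zeroQ)) m x
  transversal⇒agreement {T} (T-inj , A∘T-inj) = tail (T t₀) , (begin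
    L₀ (tail (T t₀))                  ≡⟨ A-layer₀ (T t₀) T-t₀-in-layer₀ ⟨
    A (T t₀)                          ≡⟨ sum-unique-at t₀ A≡uniform-off-t₀ sums-agree ⟩
    uniform (T t₀)                    ≡⟨ cong (λ j → Lπ (ε (i j)) m (tail (T t₀))) T-t₀-in-layer₀ ⟩
    Lπ (ε (i zeroQ)) m (tail (T t₀))  ∎)
    where
    open ≡-Reasoning
    layer = fromInjective (λ t → T t zero) (T-inj zero)
    t₀ = layer ⟨$⟩ˡ zeroQ

    T-t₀-in-layer₀ : T t₀ zero ≡ zeroQ
    T-t₀-in-layer₀ = Perm.inverseʳ layer

    A≡uniform-off-t₀ : ∀ t → t ≢ t₀ → A (T t) ≡ uniform (T t)
    A≡uniform-off-t₀ t t≢t₀ =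
      A-other-layers (T t) λ eq → t≢t₀ (T-inj zero (trans eq (sym T-t₀-in-layer₀)))

    sums-agree : sum (A ∘ T) ≡ sum (uniform ∘ T)
    sums-agree = trans (sum-injective A∘T-inj) (trans (total≡0 odd) (sym (sum-uniform T T-inj)))

  module _ (x : Cell (suc p) (suc m)) (agree : L₀ x ≡ Lπ (ε (i zeroQ)) m x) where

    private
      R : Realisation (λ j → i j ⊕ sum (λ k → x (suc k) ⊕ j)) zeroQ
      R = realisation _ zeroQ

      b c : Fin (suc p) → Fin (suc p)
      b = left R ⟨$⟩ʳ_
      c = right R ⟨$⟩ʳ_

      shift : Fin (suc p)
      shift = x zero ⊕ (⊖ b zero)

      cell : Fin (suc p) → Cell (suc p) (suc (suc m))
      cell j zero          = j
      cell j (suc zero)    = shift ⊕ b j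
      cell j (suc (suc k)) = x (suc k) ⊕ j

      -- T zero is (0, x) itself, not merely pointwise equal to cell zero, so that A (T zero)
      -- computes to L₀ x.
      T : Fin (suc p) → Cell (suc p) (suc (suc m))
      T zero    zero    = zero
      T zero    (suc k) = x k
      T (suc j)         = cell (suc j)

      T≗cell : ∀ j k → T j k ≡ cell j k
      T≗cell zero    zero          = refl
      T≗cell zero    (suc zero)    = sym (begin
        (x zero ⊕ (⊖ b zero)) ⊕ b zero  ≡⟨ ⊕-assoc (x zero) (⊖ b zero) (b zero) ⟩
        x zero ⊕ ((⊖ b zero) ⊕ b zero)  ≡⟨ cong (x zero ⊕_) (⊕-inverseˡ (b zero)) ⟩
        x zero ⊕ zeroQ                  ≡⟨ ⊕-identityʳ (x zero) ⟩
        x zero                          ∎)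
        where open ≡-Reasoning
      T≗cell zero    (suc (suc k)) = sym (⊕-identityʳ (x (suc k)))
      T≗cell (suc j) k             = refl

      cell-column-injective : ∀ k → Injective _≡_ _≡_ (λ j → cell j k)
      cell-column-injective zero          eq = eq
      cell-column-injective (suc zero)    eq = ⟨$⟩ʳ-injective (left R) (∙-cancelˡ shift _ _ eq)
      cell-column-injective (suc (suc k)) eq = ∙-cancelˡ (x (suc k)) _ _ eq

      T-column-injective : ∀ k → Injective _≡_ _≡_ (λ j → T j k)
      T-column-injective k {j} {j′} eq = cell-column-injective k (trans (sym (T≗cell j k)) (trans eq (T≗cell j′ k)))

      uniform-cell : ∀ j → uniform (cell (suc j)) ≡ shift ⊕ c (suc j)
      uniform-cell j = begin
        uniform (cell (suc j))          ≡⟨ uniform-formula (cell (suc j)) ⟩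
        S ⊕ ((shift ⊕ b (suc j)) ⊕ I)   ≡⟨ ⊕-comm S ((shift ⊕ b (suc j)) ⊕ I) ⟩
        ((shift ⊕ b (suc j)) ⊕ I) ⊕ S   ≡⟨ ⊕-assoc (shift ⊕ b (suc j)) I S ⟩
        (shift ⊕ b (suc j)) ⊕ (I ⊕ S)   ≡⟨ ⊕-assoc shift (b (suc j)) (I ⊕ S) ⟩
        shift ⊕ (b (suc j) ⊕ (I ⊕ S))   ≡⟨ cong (shift ⊕_) (realises R (suc j) λ ()) ⟨
        shift ⊕ c (suc j)               ∎
        where
        open ≡-Reasoning
        S = sum (λ k → x (suc k) ⊕ suc j)
        I = i (suc j)

      A∘T≡shift⊕c : ∀ j → A (T j) ≡ shift ⊕ c j
      A∘T≡shift⊕c zero = begin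
        A (T zero)       ≡⟨ agree ⟩
        uniform (T zero) ≡⟨ sum-unique-at zero off-zero sums-agree ⟩
        shift ⊕ c zero   ∎
        where
        open ≡-Reasoning
        off-zero : ∀ j → j ≢ zero → uniform (T j) ≡ shift ⊕ c j
        off-zero zero    0≢0 = contradiction refl 0≢0
        off-zero (suc j) _   = uniform-cell j
        sums-agree : sum (uniform ∘ T) ≡ sum (λ j → shift ⊕ c j)
        sums-agree = trans (sum-uniform T T-column-injective)
          (sym (trans (sum-injective (⟨$⟩ʳ-injective (right R) ∘ ∙-cancelˡ shift _ _)) (total≡0 odd)))
      A∘T≡shift⊕c (suc j) = trans (A-other-layers (T (suc j)) λ ()) (uniform-cell j)

    agreement⇒transversal : HasTransversal A
    agreement⇒transversal = T , T-column-injective , λ {j} {j′} eq →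
      ⟨$⟩ʳ-injective (right R)
        (∙-cancelˡ shift _ _ (trans (sym (A∘T≡shift⊕c j)) (trans eq (A∘T≡shift⊕c j′))))

lemma2 : (q : ℕ) .{{_ : NonZero q}} → q % 2 ≡ 1 →
         (m : ℕ) (i : Fin q → Fin q) → sumQ i ≡ zeroQ →
         (L₀ : Cube q (suc m)) → IsLatin L₀ →
         ((¬ HasTransversal (layerArray m L₀ i))
           ⇔ ((x : Cell q (suc m)) → L₀ x ≢ Lπ (ε (i zeroQ)) m x))
lemma2 (suc p) odd m i sum-i≡0 L₀ _ = mk⇔
  (λ no-transversal x agree → no-transversal (agreement⇒transversal x agree))
  (λ no-agreement (T , transversal) → let x , agree = transversal⇒agreement transversal in no-agreement x agree)
  where open LayerArray odd m i sum-i≡0 L₀
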